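{- Let $H$ be a connected simple graph with maximum degree exactly $3$ that is not isomorphic to $K_4$. Then the number of vertices of $H$ of degree $3$ is at least $2n_H(C_3)-2$, where $n_H(C_3)$ is the number of triangles in $H$. -}

module Defs where

open import Data.Nat using (ℕ; _<_)
open import Data.Fin using (Fin; _<_)
open import Data.Fin.Properties using ()
open import Data.Bool using (Bool; true; false)
open import Data.List using (List; []; _∷_; length; filter)
open import Data.List using (allFin)
open import Data.Product using (Σ; _×_; ∃; ∃-syntax; _,_)
open import Relation.Nullary using (¬_; Dec)
open import Relation.Unary using (Decidable)
open import Relation.Binary.PropositionalEquality using (_≡_)
open import Function.Bundles using (_⤖_; Bijection)
open import Data.List using (cartesianProduct; concatMap)

record Graph (n : ℕ) : Set₁ where
  field
    Adj   : Fin n → Fin n → Set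
    adj?  : ∀ u v → Dec (Adj u v)
    sym   : ∀ {u v} → Adj u v → Adj v u
    irrefl : ∀ {u} → ¬ Adj u u

open Graph public

degree : ∀ {n} → Graph n → Fin n → ℕ
degree G v = length (filter (adj? G v) (allFin _))

data Walk {n} (G : Graph n) : Fin n → Fin n → Set where
  here  : ∀ {u} → Walk G u u
  step  : ∀ {u w v} → Adj G u w → Walk G w v → Walk G u v

Connected : ∀ {n} → Graph n → Set
Connected G = ∀ u v → Walk G u v

MaxDegree : ∀ {n} → Graph n → ℕ → Set
MaxDegree G k = (∀ v → degree G v Data.Nat.≤ k) × (∃[ v ] degree G v ≡ k)

K : (m : ℕ) → Graph m
K m = record
  { Adj = λ u v → ¬ u ≡ v
  ; adj? = λ u v → Relation.Nullary.¬? (u Data.Fin.≟ v)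
  ; sym = λ ne eq → ne (Relation.Binary.PropositionalEquality.sym eq)
  ; irrefl = λ ne → ne Relation.Binary.PropositionalEquality.refl }

record _≅_ {n m} (G : Graph n) (H : Graph m) : Set where
  field
    f   : Fin n ⤖ Fin m
    adj⇔ : ∀ u v → (Adj G u v → Adj H (Bijection.to f u) (Bijection.to f v))
                   × (Adj H (Bijection.to f u) (Bijection.to f v) → Adj G u v)

Triangle : ∀ {n} → Graph n → Fin n × Fin n × Fin n → Set
Triangle G (u , v , w) =
  (u Data.Fin.< v) × (v Data.Fin.< w) × Adj G u v × Adj G v w × Adj G u w

triangle? : ∀ {n} (G : Graph n) → Decidable (Triangle G)
triangle? G (u , v , w) =
  (u Data.Fin.<? v) Relation.Nullary.×-dec ((v Data.Fin.<? w) Relation.Nullary.×-dec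
  (adj? G u v Relation.Nullary.×-dec (adj? G v w Relation.Nullary.×-dec adj? G u w)))

triples : ∀ n → List (Fin n × Fin n × Fin n)
triples n = cartesianProduct (allFin n) (cartesianProduct (allFin n) (allFin n))

numTriangles : ∀ {n} → Graph n → ℕ
numTriangles {n} G = length (filter (triangle? G) (triples n))

numDeg : ∀ {n} → Graph n → ℕ → ℕ
numDeg {n} G k = length (filter (λ v → degree G v Data.Nat.≟ k) (allFin n))

module Submission where

-- The number t of triangles of H is at most its cycle rank e − n + 1, and since all degrees are at
-- most 3 the handshake lemma gives 2e ≤ 2n + n₃; together, 2t − 2 ≤ n₃.
-- The first inequality is proved by growing a vertex set S from one vertex, adding a neighbour w of
-- S at each step, while keeping |S| + t(S) ≤ e(S) + 1. If w has k ∈ {1, 2, 3} neighbours in S, the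
-- step adds k edges and one triangle for each edge among these neighbours. There are at most k − 1
-- such edges unless k = 3 and the neighbours span a triangle; but then w and its neighbours form a
-- K₄, which is all of H because H is connected and no vertex has a fourth neighbour.
-- Edges and triangles are counted as ordered pairs and triples (E = 2e, T = 6t) of the indicator
-- vector of S, so that adding a vertex to S is a polynomial identity in that vector.

open import Defs renaming (sym to adj-sym)
open import Data.Nat as ℕ using (ℕ; zero; suc; _+_; _*_; _∸_; _≤_; _<_; z≤n; s≤s; s≤s⁻¹)
open import Relation.Nullary using (¬_)

open import Data.Bool.Base using (true; false; if_then_else_)
open import Data.Fin.Base as Fin using (Fin; zero; suc; punchIn)
open import Data.Fin.Patterns using (0F; 1F; 2F; 3F)
open import Data.Fin.Properties
  using (_≟_; _<?_; <-cmp; <-asym; <-trans; <-irrefl; toℕ<n; any?; ¬∀⟶∃¬; punchIn-injective; punchInᵢ≢i)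
open import Data.Fin.Subset using (Subset; inside; outside; _∈_; _∉_; _∪_; ⁅_⁆; ∣_∣)
import Data.Fin.Subset as Subset
open import Data.Fin.Subset.Properties
  using (_∈?_; x∈p∪q⁺; x∈p∪q⁻; x∈⁅x⁆; x∈⁅y⁆⇒x≡y; ∈⊤; p⊆q⇒∣p∣≤∣q∣; ∣⊤∣≡n; ∣⁅x⁆∣≡1; ∣p∣≡n⇒p≡⊤)
open import Data.List.Base using (List; []; _∷_; length; filter; tabulate; map; _++_; cartesianProduct)
import Data.List.Membership.Propositional as List
open import Data.List.Properties using (filter-++; length-++)
open import Data.List.Relation.Unary.All using (All; []; _∷_)
import Data.List.Relation.Unary.All.Properties as All
open import Data.List.Relation.Unary.AllPairs using ([]; _∷_)
open import Data.List.Relation.Unary.Any using (here; there)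
open import Data.List.Relation.Unary.Unique.Propositional using (Unique)
import Data.List.Relation.Unary.Unique.Propositional.Properties as Unique
import Data.Nat.ListAction as ListAction
open import Data.Nat.Properties
  using ( ≤-refl; ≤-reflexive; ≤-trans; <⇒≱; ≰⇒>; n<1+n; suc-injective; +-comm; +-suc; +-identityʳ
        ; +-mono-≤; +-monoˡ-≤; +-cancelˡ-≤; *-assoc; *-comm; *-identityˡ; *-identityʳ; *-zeroʳ; *-distribʳ-+
        ; *-monoˡ-≤; *-monoʳ-≤; *-cancelˡ-≤; m≤n+m; m∸n≤m; m+[n∸m]≡n; m∸n+n≡m; m≤n+o⇒m∸n≤o
        ; m+n≡0⇒m≡0; m+n≡0⇒n≡0; +-*-semiring; *-commutativeSemigroup)
open import Data.Nat.Tactic.RingSolver using (solve-∀)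
open import Data.Product.Base using (_×_; _,_; ∃-syntax; proj₁; proj₂)
open import Data.Sum.Base using (_⊎_; inj₁; inj₂)
open import Data.Vec.Base using ([]; _∷_)
open import Function.Base using (id; _∘_; case_of_)
open import Function.Bundles using (mk↔ₛ′)
open import Function.Properties.Inverse using (↔⇒⤖)
open import Level using (Level)
open import Relation.Binary.Definitions using (tri<; tri≈; tri>)
open import Relation.Binary.PropositionalEquality
  using (_≡_; _≢_; refl; sym; trans; cong; cong₂; subst; subst₂; module ≡-Reasoning)
open import Relation.Nullary.Decidable.Core using (Dec; yes; no; does; _×-dec_)
open import Relation.Nullary.Negation.Core using (contradiction)
open import Relation.Unary using (Pred; Decidable)

open import Algebra.Properties.CommutativeSemigroup *-commutativeSemigroup using (xy∙z≈xz∙y; xy∙z≈zy∙x)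
open import Algebra.Properties.Semiring.Sum +-*-semiring
  using (sum; sum-syntax; sum-cong-≗; ∑-distrib-+; ∑-comm; *-distribˡ-sum; *-distribʳ-sum; sum-replicate-zero)
open ≡-Reasoning

private variable
  a p : Level
  X Y : Set a
  P Q : Set p
  n : ℕ

𝟙 : Dec P → ℕ
𝟙 d = if does d then 1 else 0

𝟙-yes : (d : Dec P) → P → 𝟙 d ≡ 1
𝟙-yes (yes _) _ = refl
𝟙-yes (no ¬p) p = contradiction p ¬p

𝟙-no : (d : Dec P) → ¬ P → 𝟙 d ≡ 0
𝟙-no (yes p) ¬p = contradiction p ¬p
𝟙-no (no _)  _  = refl

𝟙≤1 : (d : Dec P) → 𝟙 d ≤ 1
𝟙≤1 (yes _) = ≤-refl
𝟙≤1 (no _)  = z≤n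

𝟙-pos : (d : Dec P) → 0 < 𝟙 d → P
𝟙-pos (yes p) _ = p

𝟙-×-dec : (a : Dec P) (b : Dec Q) → 𝟙 (a ×-dec b) ≡ 𝟙 a * 𝟙 b
𝟙-×-dec (yes _) (yes _) = refl
𝟙-×-dec (yes _) (no _)  = refl
𝟙-×-dec (no _)  _       = refl

δ : Fin n → Fin n → ℕ
δ c x = 𝟙 (x ≟ c)

∑-mono-≤ : {f g : Fin n → ℕ} → (∀ i → f i ≤ g i) → sum f ≤ sum g
∑-mono-≤ {zero}  f≤g = z≤n
∑-mono-≤ {suc n} f≤g = +-mono-≤ (f≤g zero) (∑-mono-≤ (f≤g ∘ suc))

∑1≡n : ∑[ i < n ] 1 ≡ n
∑1≡n {zero}  = refl
∑1≡n {suc n} = cong suc (∑1≡n {n})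

∑-δ : (c : Fin n) (f : Fin n → ℕ) → ∑[ x < n ] (δ c x * f x) ≡ f c
∑-δ {suc n} zero    f = trans (cong₂ _+_ (+-identityʳ (f zero)) (sum-replicate-zero n)) (+-identityʳ (f zero))
∑-δ {suc n} (suc c) f = ∑-δ c (f ∘ suc)

∑δ≡1 : (c : Fin n) → sum (δ c) ≡ 1
∑δ≡1 c = trans (sum-cong-≗ (λ x → sym (*-identityʳ (δ c x)))) (∑-δ c (λ _ → 1))

*≤-of-≤1 : ∀ {m} n → m ≤ 1 → m * n ≤ n
*≤-of-≤1 n m≤1 = ≤-trans (*-monoˡ-≤ n m≤1) (≤-reflexive (+-identityʳ n))

≤∑ : (f : Fin n → ℕ) (c : Fin n) → f c ≤ sum f
≤∑ f c = subst (_≤ sum f) (∑-δ c f) (∑-mono-≤ λ x → *≤-of-≤1 (f x) (𝟙≤1 (x ≟ c)))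

∑-pos : (f : Fin n → ℕ) → 0 < sum f → ∃[ i ] 0 < f i
∑-pos {suc n} f ∑f>0 with f zero in eq
... | suc _ = zero , subst (0 <_) (sym eq) (s≤s z≤n)
... | zero  with i , fi>0 ← ∑-pos (f ∘ suc) ∑f>0 = suc i , fi>0

∑≡0⇒≡0 : (f : Fin n → ℕ) → sum f ≡ 0 → ∀ i → f i ≡ 0
∑≡0⇒≡0 f ∑f≡0 zero    = m+n≡0⇒m≡0 (f zero) ∑f≡0
∑≡0⇒≡0 f ∑f≡0 (suc i) = ∑≡0⇒≡0 (f ∘ suc) (m+n≡0⇒n≡0 (f zero) ∑f≡0) i

≡0⇒∑≡0 : {f : Fin n → ℕ} → (∀ i → f i ≡ 0) → sum f ≡ 0
≡0⇒∑≡0 {n} f≡0 = trans (sum-cong-≗ f≡0) (sum-replicate-zero n)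

∑² : (Fin n → Fin n → ℕ) → ℕ
∑² {n} f = ∑[ u < n ] ∑[ v < n ] f u v

∑³ : (Fin n → Fin n → Fin n → ℕ) → ℕ
∑³ {n} f = ∑[ u < n ] ∑[ v < n ] ∑[ w < n ] f u v w

∑²-cong : {f g : Fin n → Fin n → ℕ} → (∀ u v → f u v ≡ g u v) → ∑² f ≡ ∑² g
∑²-cong {n} f≡g = sum-cong-≗ {n} (λ u → sum-cong-≗ {n} (f≡g u))

∑³-cong : {f g : Fin n → Fin n → Fin n → ℕ} → (∀ u v w → f u v w ≡ g u v w) → ∑³ f ≡ ∑³ g
∑³-cong {n} f≡g = sum-cong-≗ {n} (λ u → ∑²-cong (f≡g u))

∑²-distrib-+ : (f g : Fin n → Fin n → ℕ) → ∑² (λ u v → f u v + g u v) ≡ ∑² f + ∑² g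
∑²-distrib-+ {n} f g = trans (sum-cong-≗ (λ u → ∑-distrib-+ (f u) (g u))) (∑-distrib-+ {n} _ _)

∑³-distrib-+ : (f g : Fin n → Fin n → Fin n → ℕ) → ∑³ (λ u v w → f u v w + g u v w) ≡ ∑³ f + ∑³ g
∑³-distrib-+ {n} f g = trans (sum-cong-≗ (λ u → ∑²-distrib-+ (f u) (g u))) (∑-distrib-+ {n} _ _)

∑²-*ˡ : (c : ℕ) (f : Fin n → Fin n → ℕ) → ∑² (λ u v → c * f u v) ≡ c * ∑² f
∑²-*ˡ {n} c f = begin
  ∑[ u < n ] ∑[ v < n ] (c * f u v) ≡⟨ sum-cong-≗ {n} (λ u → *-distribˡ-sum c (f u)) ⟨
  ∑[ u < n ] (c * sum (f u))        ≡⟨ *-distribˡ-sum c (λ u → sum (f u)) ⟨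
  c * ∑² f                          ∎

∑²-δ₁ : (c : Fin n) (f : Fin n → Fin n → ℕ) → ∑² (λ u v → δ c u * f u v) ≡ sum (f c)
∑²-δ₁ {n} c f = trans (sum-cong-≗ {n} (λ u → sym (*-distribˡ-sum (δ c u) (f u)))) (∑-δ c (λ u → sum (f u)))

∑³-δ₁ : (c : Fin n) (f : Fin n → Fin n → Fin n → ℕ) → ∑³ (λ u v w → δ c u * f u v w) ≡ ∑² (f c)
∑³-δ₁ {n} c f = trans (sum-cong-≗ {n} (λ u → ∑²-*ˡ (δ c u) (f u))) (∑-δ c (λ u → ∑² (f u)))

∑³≡0 : {f : Fin n → Fin n → Fin n → ℕ} → (∀ u v w → f u v w ≡ 0) → ∑³ f ≡ 0
∑³≡0 f≡0 = ≡0⇒∑≡0 λ u → ≡0⇒∑≡0 λ v → ≡0⇒∑≡0 (f≡0 u v)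

δδ-diagonal : (c : Fin n) (f : Fin n → Fin n → ℕ) → f c c ≡ 0 → ∀ u v → δ c u * δ c v * f u v ≡ 0
δδ-diagonal c f fcc≡0 u v with u ≟ c | v ≟ c
... | yes refl | yes refl = trans (+-identityʳ (f c c)) fcc≡0
... | yes _    | no _     = refl
... | no _     | _        = refl

∑³-swap₁₂ : (f : Fin n → Fin n → Fin n → ℕ) → ∑³ (λ u v w → f v u w) ≡ ∑³ f
∑³-swap₁₂ {n} f = ∑-comm {n} {n} (λ u v → sum (f v u))

∑³-swap₂₃ : (f : Fin n → Fin n → Fin n → ℕ) → ∑³ (λ u v w → f u w v) ≡ ∑³ f
∑³-swap₂₃ {n} f = sum-cong-≗ (λ u → ∑-comm {n} {n} (λ v w → f u w v))

∑³-permutations : (f : Fin n → Fin n → Fin n → ℕ) →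
  ∑³ (λ u v w → f u v w + f u w v + f v u w + f v w u + f w u v + f w v u) ≡ 6 * ∑³ f
∑³-permutations {n} f = begin
  ∑³ (λ u v w → f u v w + f₁₃₂ u v w + f₂₁₃ u v w + f₂₃₁ u v w + f₃₁₂ u v w + f₃₂₁ u v w)
    ≡⟨ ∑³-distrib-+ _ f₃₂₁ ⟩
  ∑³ (λ u v w → f u v w + f₁₃₂ u v w + f₂₁₃ u v w + f₂₃₁ u v w + f₃₁₂ u v w) + ∑³ f₃₂₁
    ≡⟨ cong (_+ ∑³ f₃₂₁) (∑³-distrib-+ _ f₃₁₂) ⟩
  ∑³ (λ u v w → f u v w + f₁₃₂ u v w + f₂₁₃ u v w + f₂₃₁ u v w) + ∑³ f₃₁₂ + ∑³ f₃₂₁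
    ≡⟨ cong (λ s → s + ∑³ f₃₁₂ + ∑³ f₃₂₁) (∑³-distrib-+ _ f₂₃₁) ⟩
  ∑³ (λ u v w → f u v w + f₁₃₂ u v w + f₂₁₃ u v w) + ∑³ f₂₃₁ + ∑³ f₃₁₂ + ∑³ f₃₂₁
    ≡⟨ cong (λ s → s + ∑³ f₂₃₁ + ∑³ f₃₁₂ + ∑³ f₃₂₁) (∑³-distrib-+ _ f₂₁₃) ⟩
  ∑³ (λ u v w → f u v w + f₁₃₂ u v w) + ∑³ f₂₁₃ + ∑³ f₂₃₁ + ∑³ f₃₁₂ + ∑³ f₃₂₁
    ≡⟨ cong (λ s → s + ∑³ f₂₁₃ + ∑³ f₂₃₁ + ∑³ f₃₁₂ + ∑³ f₃₂₁) (∑³-distrib-+ f f₁₃₂) ⟩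
  ∑³ f + ∑³ f₁₃₂ + ∑³ f₂₁₃ + ∑³ f₂₃₁ + ∑³ f₃₁₂ + ∑³ f₃₂₁
    ≡⟨ cong₂ _+_ (cong₂ _+_ (cong₂ _+_ (cong₂ _+_ (cong (∑³ f +_) ∑f₁₃₂) ∑f₂₁₃) ∑f₂₃₁) ∑f₃₁₂) ∑f₃₂₁ ⟩
  ∑³ f + ∑³ f + ∑³ f + ∑³ f + ∑³ f + ∑³ f
    ≡⟨ six-times (∑³ f) ⟩
  6 * ∑³ f ∎
  where
  f₁₃₂ f₂₁₃ f₂₃₁ f₃₁₂ f₃₂₁ : Fin n → Fin n → Fin n → ℕ
  f₁₃₂ u v w = f u w v
  f₂₁₃ u v w = f v u w
  f₂₃₁ u v w = f v w u
  f₃₁₂ u v w = f w u v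
  f₃₂₁ u v w = f w v u
  ∑f₁₃₂ : ∑³ f₁₃₂ ≡ ∑³ f
  ∑f₁₃₂ = ∑³-swap₂₃ f
  ∑f₂₁₃ : ∑³ f₂₁₃ ≡ ∑³ f
  ∑f₂₁₃ = ∑³-swap₁₂ f
  ∑f₂₃₁ : ∑³ f₂₃₁ ≡ ∑³ f
  ∑f₂₃₁ = trans (∑³-swap₁₂ f₁₃₂) ∑f₁₃₂
  ∑f₃₁₂ : ∑³ f₃₁₂ ≡ ∑³ f
  ∑f₃₁₂ = trans (∑³-swap₂₃ f₂₁₃) ∑f₂₁₃
  ∑f₃₂₁ : ∑³ f₃₂₁ ≡ ∑³ f
  ∑f₃₂₁ = trans (∑³-swap₂₃ f₂₃₁) ∑f₂₃₁
  six-times : ∀ x → x + x + x + x + x + x ≡ 6 * x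
  six-times = solve-∀

drop-vanishing : ∀ {x y z} → x ≡ y + z → z ≡ 0 → x ≡ y
drop-vanishing {y = y} x≡y+z refl = trans x≡y+z (+-identityʳ y)

-- 0/1 vectors as lists of points

occurrences : List (Fin n) → Fin n → ℕ
occurrences []       x = 0
occurrences (a ∷ as) x = δ a x + occurrences as x

∑-occurrences : ∀ as (g : Fin n → ℕ) → ∑[ x < n ] (occurrences as x * g x) ≡ ListAction.sum (map g as)
∑-occurrences {n} []       g = sum-replicate-zero n
∑-occurrences {n} (a ∷ as) g = begin
  ∑[ x < n ] ((δ a x + occurrences as x) * g x)
    ≡⟨ sum-cong-≗ (λ x → *-distribʳ-+ (g x) (δ a x) _) ⟩
  ∑[ x < n ] (δ a x * g x + occurrences as x * g x)
    ≡⟨ ∑-distrib-+ (λ x → δ a x * g x) _ ⟩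
  ∑[ x < n ] (δ a x * g x) + ∑[ x < n ] (occurrences as x * g x)
    ≡⟨ cong₂ _+_ (∑-δ a g) (∑-occurrences as g) ⟩
  g a + ListAction.sum (map g as) ∎

∑-occurrences≡length : (as : List (Fin n)) → sum (occurrences as) ≡ length as
∑-occurrences≡length {n} []       = sum-replicate-zero n
∑-occurrences≡length (a ∷ as) =
  trans (∑-distrib-+ (δ a) (occurrences as)) (cong₂ _+_ (∑δ≡1 a) (∑-occurrences≡length as))

∈⇒0<occurrences : {x : Fin n} {as : List (Fin n)} → x List.∈ as → 0 < occurrences as x
∈⇒0<occurrences {x = x} (here refl) rewrite 𝟙-yes (x ≟ x) refl = s≤s z≤n
∈⇒0<occurrences {x = x} {as = a ∷ _} (there x∈as) = ≤-trans (∈⇒0<occurrences x∈as) (m≤n+m _ (δ a x))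

≤1⇒occurrences : ∀ k (r : Fin n → ℕ) → (∀ x → r x ≤ 1) → sum r ≡ k →
                 ∃[ as ] length as ≡ k × (∀ x → r x ≡ occurrences as x)
≤1⇒occurrences zero    r r≤1 ∑r≡0 = [] , refl , ∑≡0⇒≡0 r ∑r≡0
≤1⇒occurrences (suc k) r r≤1 ∑r≡1+k = peel (∑-pos r (subst (0 <_) (sym ∑r≡1+k) (s≤s z≤n)))
  where
  peel : ∃[ a ] 0 < r a → ∃[ as ] length as ≡ suc k × (∀ x → r x ≡ occurrences as x)
  peel (a , ra>0) =
    let as , |as|≡k , r′≗as = ≤1⇒occurrences k r′ (λ x → ≤-trans (m∸n≤m (r x) (δ a x)) (r≤1 x)) ∑r′≡k
    in a ∷ as , cong suc |as|≡k , λ x → trans (split x) (cong (δ a x +_) (r′≗as x))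
    where
    r′ : Fin _ → ℕ
    r′ x = r x ∸ δ a x
    δ≤r : ∀ x → δ a x ≤ r x
    δ≤r x with x ≟ a
    ... | yes refl = ra>0
    ... | no _     = z≤n
    split : ∀ x → r x ≡ δ a x + r′ x
    split x = sym (m+[n∸m]≡n (δ≤r x))
    ∑r′≡k : sum r′ ≡ k
    ∑r′≡k = suc-injective (begin
      suc (sum r′)              ≡⟨ cong (_+ sum r′) (∑δ≡1 a) ⟨
      sum (δ a) + sum r′        ≡⟨ ∑-distrib-+ (δ a) r′ ⟨
      ∑[ x < _ ] (δ a x + r′ x) ≡⟨ sum-cong-≗ split ⟨
      sum r                     ≡⟨ ∑r≡1+k ⟩
      suc k                     ∎)

occurrences-∉ : ∀ {x : Fin n} {as} → All (x ≢_) as → occurrences as x ≡ 0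
occurrences-∉ []            = refl
occurrences-∉ {x = x} {a ∷ _} (x≢a ∷ x∉as) = cong₂ _+_ (𝟙-no (x ≟ a) x≢a) (occurrences-∉ x∉as)

occurrences≤𝟙 : {P : Pred (Fin n) p} (P? : Decidable P) {as : List (Fin n)} →
                Unique as → All P as → ∀ x → occurrences as x ≤ 𝟙 (P? x)
occurrences≤𝟙 P? []                   []         x = z≤n
occurrences≤𝟙 P? {a ∷ _} (a∉as ∷ uniq) (Pa ∷ Pas) x with x ≟ a
... | yes refl = ≤-reflexive (trans (cong suc (occurrences-∉ a∉as)) (sym (𝟙-yes (P? x) Pa)))
... | no _     = occurrences≤𝟙 P? uniq Pas x

Unique⇒length≤∑𝟙 : {P : Pred (Fin n) p} (P? : Decidable P) {as : List (Fin n)} →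
                   Unique as → All P as → length as ≤ ∑[ x < n ] 𝟙 (P? x)
Unique⇒length≤∑𝟙 P? {as} uniq all =
  subst (_≤ _) (∑-occurrences≡length as) (∑-mono-≤ (occurrences≤𝟙 P? uniq all))

length-filter-tabulate : {P : Pred X p} (P? : Decidable P) (f : Fin n → X) →
                         length (filter P? (tabulate f)) ≡ ∑[ i < n ] 𝟙 (P? (f i))
length-filter-tabulate {n = zero}  P? f = refl
length-filter-tabulate {n = suc n} P? f with does (P? (f zero))
... | true  = cong suc (length-filter-tabulate P? (f ∘ suc))
... | false = length-filter-tabulate P? (f ∘ suc)

length-filter-map : {P : Pred Y p} (P? : Decidable P) (f : X → Y) (xs : List X) →
                    length (filter P? (map f xs)) ≡ length (filter (P? ∘ f) xs)
length-filter-map P? f []       = refl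
length-filter-map P? f (x ∷ xs) with does (P? (f x))
... | true  = cong suc (length-filter-map P? f xs)
... | false = length-filter-map P? f xs

length-filter-cartesianProduct : {P : Pred (X × Y) p} (P? : Decidable P) (f : Fin n → X) (ys : List Y) →
  length (filter P? (cartesianProduct (tabulate f) ys)) ≡ ∑[ i < n ] length (filter (λ y → P? (f i , y)) ys)
length-filter-cartesianProduct {n = zero}  P? f ys = refl
length-filter-cartesianProduct {X = X} {Y = Y} {n = suc n} P? f ys = begin
  length (filter P? (map (f zero ,_) ys ++ rest))          ≡⟨ cong length (filter-++ P? (map (f zero ,_) ys) rest) ⟩
  length (filter P? (map (f zero ,_) ys) ++ filter P? rest) ≡⟨ length-++ (filter P? (map (f zero ,_) ys)) ⟩
  length (filter P? (map (f zero ,_) ys)) + length (filter P? rest)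
    ≡⟨ cong₂ _+_ (length-filter-map P? (f zero ,_) ys) (length-filter-cartesianProduct P? (f ∘ suc) ys) ⟩
  ∑[ i < suc n ] length (filter (λ y → P? (f i , y)) ys) ∎
  where
  rest : List (X × Y)
  rest = cartesianProduct (tabulate (f ∘ suc)) ys

[_<_] : Fin n → Fin n → ℕ
[ a < b ] = 𝟙 (a <? b)

<⇒[<]≡1 : {a b : Fin n} → a Fin.< b → [ a < b ] ≡ 1
<⇒[<]≡1 {a = a} {b} a<b = 𝟙-yes (a <? b) a<b

<⇒[>]≡0 : {a b : Fin n} → a Fin.< b → [ b < a ] ≡ 0
<⇒[>]≡0 {a = a} {b} a<b = 𝟙-no (b <? a) (<-asym a<b)

sorted : Fin n → Fin n → Fin n → ℕ
sorted u v w = [ u < v ] * [ v < w ]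

sortings : Fin n → Fin n → Fin n → ℕ
sortings u v w = sorted u v w + sorted u w v + sorted v u w + sorted v w u + sorted w u v + sorted w v u

sortings≡1 : {u v w : Fin n} → u ≢ v → v ≢ w → u ≢ w → sortings u v w ≡ 1
sortings≡1 {u = u} {v} {w} u≢v v≢w u≢w with <-cmp u v | <-cmp v w | <-cmp u w
... | tri≈ _ u≡v _ | _ | _ = contradiction u≡v u≢v
... | _ | tri≈ _ v≡w _ | _ = contradiction v≡w v≢w
... | _ | _ | tri≈ _ u≡w _ = contradiction u≡w u≢w
... | tri< p _ _ | tri< q _ _ | tri> _ _ r = contradiction (<-trans (<-trans p q) r) (<-irrefl refl)
... | tri> _ _ p | tri> _ _ q | tri< r _ _ = contradiction (<-trans (<-trans r q) p) (<-irrefl refl)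
... | tri< p _ _ | tri< q _ _ | tri< r _ _
    rewrite <⇒[<]≡1 p | <⇒[>]≡0 p | <⇒[<]≡1 q | <⇒[>]≡0 q | <⇒[<]≡1 r | <⇒[>]≡0 r = refl
... | tri< p _ _ | tri> _ _ q | tri< r _ _
    rewrite <⇒[<]≡1 p | <⇒[>]≡0 p | <⇒[<]≡1 q | <⇒[>]≡0 q | <⇒[<]≡1 r | <⇒[>]≡0 r = refl
... | tri< p _ _ | tri> _ _ q | tri> _ _ r
    rewrite <⇒[<]≡1 p | <⇒[>]≡0 p | <⇒[<]≡1 q | <⇒[>]≡0 q | <⇒[<]≡1 r | <⇒[>]≡0 r = refl
... | tri> _ _ p | tri< q _ _ | tri< r _ _
    rewrite <⇒[<]≡1 p | <⇒[>]≡0 p | <⇒[<]≡1 q | <⇒[>]≡0 q | <⇒[<]≡1 r | <⇒[>]≡0 r = refl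
... | tri> _ _ p | tri< q _ _ | tri> _ _ r
    rewrite <⇒[<]≡1 p | <⇒[>]≡0 p | <⇒[<]≡1 q | <⇒[>]≡0 q | <⇒[<]≡1 r | <⇒[>]≡0 r = refl
... | tri> _ _ p | tri> _ _ q | tri> _ _ r
    rewrite <⇒[<]≡1 p | <⇒[>]≡0 p | <⇒[<]≡1 q | <⇒[>]≡0 q | <⇒[<]≡1 r | <⇒[>]≡0 r = refl

χ : Subset n → Fin n → ℕ
χ s x = 𝟙 (x ∈? s)

χ≤1 : (s : Subset n) → ∀ x → χ s x ≤ 1
χ≤1 s x = 𝟙≤1 (x ∈? s)

∑χ≡∣∣ : (s : Subset n) → sum (χ s) ≡ ∣ s ∣
∑χ≡∣∣ []            = refl
∑χ≡∣∣ (inside ∷ s)  = cong suc (∑χ≡∣∣ s)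
∑χ≡∣∣ (outside ∷ s) = ∑χ≡∣∣ s

χ-∪⁅⁆ : ∀ {s : Subset n} {w} → w ∉ s → ∀ x → χ (s ∪ ⁅ w ⁆) x ≡ χ s x + δ w x
χ-∪⁅⁆ {s = s} {w} w∉s x with x ∈? s | x ≟ w
... | yes x∈s | yes refl = contradiction x∈s w∉s
... | yes x∈s | no _     = 𝟙-yes (x ∈? s ∪ ⁅ w ⁆) (x∈p∪q⁺ (inj₁ x∈s))
... | no _    | yes refl = 𝟙-yes (x ∈? s ∪ ⁅ w ⁆) (x∈p∪q⁺ (inj₂ (x∈⁅x⁆ x)))
... | no x∉s  | no x≢w   = 𝟙-no (x ∈? s ∪ ⁅ w ⁆) λ x∈ → case x∈p∪q⁻ s ⁅ w ⁆ x∈ of λ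
  { (inj₁ x∈s)  → x∉s x∈s
  ; (inj₂ x∈⁅w⁆) → x≢w (x∈⁅y⁆⇒x≡y w x∈⁅w⁆) }

∣∪⁅⁆∣ : ∀ {s : Subset n} {w} → w ∉ s → ∣ s ∪ ⁅ w ⁆ ∣ ≡ suc ∣ s ∣
∣∪⁅⁆∣ {n} {s} {w} w∉s = begin
  ∣ s ∪ ⁅ w ⁆ ∣                ≡⟨ ∑χ≡∣∣ (s ∪ ⁅ w ⁆) ⟨
  sum (χ (s ∪ ⁅ w ⁆))          ≡⟨ sum-cong-≗ {n} (χ-∪⁅⁆ w∉s) ⟩
  ∑[ x < n ] (χ s x + δ w x)   ≡⟨ ∑-distrib-+ (χ s) (δ w) ⟩
  sum (χ s) + sum (δ w)        ≡⟨ cong₂ _+_ (∑χ≡∣∣ s) (∑δ≡1 w) ⟩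
  ∣ s ∣ + 1                    ≡⟨ +-comm ∣ s ∣ 1 ⟩
  suc ∣ s ∣                    ∎

χ-⁅⁆ : (w x : Fin n) → χ ⁅ w ⁆ x ≡ δ w x
χ-⁅⁆ w x with x ≟ w
... | yes refl = 𝟙-yes (x ∈? ⁅ x ⁆) (x∈⁅x⁆ x)
... | no x≢w   = 𝟙-no (x ∈? ⁅ w ⁆) (x≢w ∘ x∈⁅y⁆⇒x≡y w)

χ-⊤ : (x : Fin n) → χ Subset.⊤ x ≡ 1
χ-⊤ x = 𝟙-yes (x ∈? Subset.⊤) ∈⊤

∣∣<n⇒∃∉ : (s : Subset n) → ∣ s ∣ < n → ∃[ x ] x ∉ s
∣∣<n⇒∃∉ {n} s ∣s∣<n = ¬∀⟶∃¬ n (_∈ s) (_∈? s) λ ∀∈s →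
  <⇒≱ ∣s∣<n (subst (_≤ ∣ s ∣) (∣⊤∣≡n n) (p⊆q⇒∣p∣≤∣q∣ {p = Subset.⊤} (λ {x} _ → ∀∈s x)))

2+p≤2*k : ∀ {k p} → 0 < k → k ≤ 3 → p + k ≤ k * k → (k ≡ 3 → ¬ 5 ≤ p) → 2 + p ≤ 2 * k
2+p≤2*k {1} {p} _ _ p+1≤1 _ = s≤s (s≤s (s≤s⁻¹ (subst (_≤ 1) (+-comm p 1) p+1≤1)))
2+p≤2*k {2} {p} _ _ p+2≤4 _ = subst (_≤ 4) (+-comm p 2) p+2≤4
2+p≤2*k {3} {p} _ _ _ ¬5≤p = s≤s (s≤s (s≤s⁻¹ (≰⇒> (¬5≤p refl))))
2+p≤2*k {suc (suc (suc (suc _)))} _ (s≤s (s≤s (s≤s ()))) _ _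

s≤2⇒5≰2*s : ∀ {s} → s ≤ 2 → ¬ 5 ≤ 2 * s
s≤2⇒5≰2*s s≤2 = <⇒≱ (s≤s (*-monoʳ-≤ 2 s≤2))

all-positive : ∀ {x y z} → x ≤ 1 → y ≤ 1 → z ≤ 1 → 5 ≤ 2 * (x + y + z) → 0 < x × 0 < y × 0 < z
all-positive (s≤s z≤n) (s≤s z≤n) (s≤s z≤n) _ = s≤s z≤n , s≤s z≤n , s≤s z≤n
all-positive z≤n y≤1 z≤1 5≤ = contradiction 5≤ (s≤2⇒5≰2*s (+-mono-≤ (+-mono-≤ (z≤n {0}) y≤1) z≤1))
all-positive x≤1 z≤n z≤1 5≤ = contradiction 5≤ (s≤2⇒5≰2*s (+-mono-≤ (+-mono-≤ x≤1 (z≤n {0})) z≤1))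
all-positive x≤1 y≤1 z≤n 5≤ = contradiction 5≤ (s≤2⇒5≰2*s (+-mono-≤ (+-mono-≤ x≤1 y≤1) (z≤n {0})))

2t∸2≤d : ∀ n t e d → 6 * n + 6 * t ≤ 3 * e + 6 → e ≤ 2 * n + d → 2 * t ∸ 2 ≤ d
2t∸2≤d n t e d bound handshake =
  m≤n+o⇒m∸n≤o (2 * t) 2 (*-cancelˡ-≤ 3 (+-cancelˡ-≤ (6 * n) _ _ combined))
  where
  lhs : ∀ n t → 6 * n + 6 * t ≡ 6 * n + 3 * (2 * t)
  lhs = solve-∀
  rhs : ∀ n d → 3 * (2 * n + d) + 6 ≡ 6 * n + 3 * (2 + d)
  rhs = solve-∀
  combined : 6 * n + 3 * (2 * t) ≤ 6 * n + 3 * (2 + d)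
  combined = subst₂ _≤_ (lhs n t) (rhs n d) (≤-trans bound (+-monoˡ-≤ 6 (*-monoʳ-≤ 3 handshake)))

module _ {n} (H : Graph n) where

  A : Fin n → Fin n → ℕ
  A u v = 𝟙 (adj? H u v)

  A-sym : ∀ u v → A u v ≡ A v u
  A-sym u v with adj? H u v | adj? H v u
  ... | yes _  | yes _   = refl
  ... | no _   | no _    = refl
  ... | yes uv | no ¬vu  = contradiction (adj-sym H uv) ¬vu
  ... | no ¬uv | yes vu  = contradiction (adj-sym H vu) ¬uv

  A-irrefl : ∀ u → A u u ≡ 0
  A-irrefl u = 𝟙-no (adj? H u u) (irrefl H)

  A≤1 : ∀ u v → A u v ≤ 1
  A≤1 u v = 𝟙≤1 (adj? H u v)

  Adj⇒A≡1 : ∀ {u v} → Adj H u v → A u v ≡ 1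
  Adj⇒A≡1 {u} {v} = 𝟙-yes (adj? H u v)

  A>0⇒Adj : ∀ {u v} → 0 < A u v → Adj H u v
  A>0⇒Adj {u} {v} = 𝟙-pos (adj? H u v)

  Adj⇒≢ : ∀ {u v} → Adj H u v → u ≢ v
  Adj⇒≢ uv refl = irrefl H uv

  degree≡∑A : ∀ v → degree H v ≡ sum (A v)
  degree≡∑A v = length-filter-tabulate (adj? H v) id

  Unique⇒length≤degree : ∀ {y as} → Unique as → All (Adj H y) as → length as ≤ degree H y
  Unique⇒length≤degree {y} uniq adj = subst (_ ≤_) (sym (degree≡∑A y)) (Unique⇒length≤∑𝟙 (adj? H y) uniq adj)

  ∑²A≤2n+numDeg3 : (∀ v → degree H v ≤ 3) → ∑² A ≤ 2 * n + numDeg H 3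
  ∑²A≤2n+numDeg3 deg≤3 = subst₂ _≤_ ∑deg≡∑²A ∑≡2n+numDeg3 (∑-mono-≤ λ v → split (degree H v) (deg≤3 v))
    where
    split : ∀ d → d ≤ 3 → d ≤ 2 + 𝟙 (d ℕ.≟ 3)
    split 0 _ = z≤n
    split 1 _ = s≤s z≤n
    split 2 _ = s≤s (s≤s z≤n)
    split 3 _ = ≤-refl
    split (suc (suc (suc (suc _)))) (s≤s (s≤s (s≤s ())))
    ∑deg≡∑²A : ∑[ v < n ] degree H v ≡ ∑² A
    ∑deg≡∑²A = sum-cong-≗ {n} degree≡∑A
    ∑≡2n+numDeg3 : ∑[ v < n ] (2 + 𝟙 (degree H v ℕ.≟ 3)) ≡ 2 * n + numDeg H 3
    ∑≡2n+numDeg3 = begin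
      ∑[ v < n ] (2 + 𝟙 (degree H v ℕ.≟ 3))          ≡⟨ ∑-distrib-+ (λ _ → 2) (λ v → 𝟙 (degree H v ℕ.≟ 3)) ⟩
      ∑[ v < n ] 2 + ∑[ v < n ] 𝟙 (degree H v ℕ.≟ 3) ≡⟨ cong₂ _+_ ∑2≡2n (length-filter-tabulate (λ v → degree H v ℕ.≟ 3) id) ⟨
      2 * n + numDeg H 3 ∎
      where
      ∑2≡2n : 2 * n ≡ ∑[ v < n ] 2
      ∑2≡2n = trans (cong (2 *_) (sym (∑1≡n {n}))) (*-distribˡ-sum 2 (λ (_ : Fin n) → 1))

  Δ : Fin n → Fin n → Fin n → ℕ
  Δ u v w = A u v * A v w * A u w

  Δ-swap₁₂ : ∀ u v w → Δ v u w ≡ Δ u v w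
  Δ-swap₁₂ u v w rewrite A-sym v u = xy∙z≈xz∙y (A u v) (A u w) (A v w)

  Δ-swap₂₃ : ∀ u v w → Δ u w v ≡ Δ u v w
  Δ-swap₂₃ u v w rewrite A-sym w v = xy∙z≈zy∙x (A u w) (A v w) (A u v)

  Δ-diagonal₁₂ : ∀ w x → Δ w w x ≡ 0
  Δ-diagonal₁₂ w x = cong (λ a → a * A w x * A w x) (A-irrefl w)

  Δ-diagonal₁₃ : ∀ w v → Δ w v w ≡ 0
  Δ-diagonal₁₃ w v = trans (cong (A w v * A v w *_) (A-irrefl w)) (*-zeroʳ (A w v * A v w))

  Δ-diagonal₂₃ : ∀ u w → Δ u w w ≡ 0
  Δ-diagonal₂₃ u w = trans (cong (λ a → A u w * a * A u w) (A-irrefl w)) (cong (_* A u w) (*-zeroʳ (A u w)))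

  Δ≡0⊎distinct : ∀ u v w → Δ u v w ≡ 0 ⊎ (u ≢ v × v ≢ w × u ≢ w)
  Δ≡0⊎distinct u v w with adj? H u v | adj? H v w | adj? H u w
  ... | yes uv | yes vw | yes uw = inj₂ (Adj⇒≢ uv , Adj⇒≢ vw , Adj⇒≢ uw)
  ... | no _   | _      | _      = inj₁ refl
  ... | yes _  | no _   | _      = inj₁ refl
  ... | yes _  | yes _  | no _   = inj₁ refl

  sortedΔ : Fin n → Fin n → Fin n → ℕ
  sortedΔ u v w = sorted u v w * Δ u v w

  sortings*Δ≡Δ : ∀ u v w → sortings u v w * Δ u v w ≡ Δ u v w
  sortings*Δ≡Δ u v w with Δ≡0⊎distinct u v w
  ... | inj₁ Δ≡0 rewrite Δ≡0 = *-zeroʳ (sortings u v w)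
  ... | inj₂ (u≢v , v≢w , u≢w) rewrite sortings≡1 u≢v v≢w u≢w = *-identityˡ (Δ u v w)

  Δ≡∑sortedΔ : ∀ u v w → Δ u v w ≡
    sortedΔ u v w + sortedΔ u w v + sortedΔ v u w + sortedΔ v w u + sortedΔ w u v + sortedΔ w v u
  Δ≡∑sortedΔ u v w
    rewrite Δ-swap₂₃ v u w | Δ-swap₂₃ w u v | Δ-swap₁₂ u w v | Δ-swap₁₂ u v w | Δ-swap₂₃ u v w
    = sym (trans (factor (sorted u v w) (sorted u w v) (sorted v u w) (sorted v w u) (sorted w u v) (sorted w v u) (Δ u v w))
                 (sortings*Δ≡Δ u v w))
    where
    factor : ∀ a b c d e f m → a * m + b * m + c * m + d * m + e * m + f * m ≡ (a + b + c + d + e + f) * m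
    factor = solve-∀

  numTriangles≡∑³sortedΔ : numTriangles H ≡ ∑³ sortedΔ
  numTriangles≡∑³sortedΔ =
    trans (length-filter-cartesianProduct (triangle? H) id _) (sum-cong-≗ {n} λ u →
    trans (length-filter-cartesianProduct (λ y → triangle? H (u , y)) id _) (sum-cong-≗ {n} λ v →
    trans (length-filter-tabulate (λ w → triangle? H (u , v , w)) id) (sum-cong-≗ {n} λ w →
    𝟙-triangle u v w)))
    where
    𝟙-triangle : ∀ u v w → 𝟙 (triangle? H (u , v , w)) ≡ sortedΔ u v w
    𝟙-triangle u v w = begin
      𝟙 (u<v ×-dec (v<w ×-dec (uv ×-dec (vw ×-dec uw))))
        ≡⟨ trans (𝟙-×-dec u<v (v<w ×-dec (uv ×-dec (vw ×-dec uw)))) (cong ([ u < v ] *_)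
           (trans (𝟙-×-dec v<w (uv ×-dec (vw ×-dec uw))) (cong ([ v < w ] *_)
           (trans (𝟙-×-dec uv (vw ×-dec uw)) (cong (A u v *_) (𝟙-×-dec vw uw)))))) ⟩
      [ u < v ] * ([ v < w ] * (A u v * (A v w * A u w)))
        ≡⟨ reassociate [ u < v ] [ v < w ] (A u v) (A v w) (A u w) ⟩
      sortedΔ u v w ∎
      where
      u<v : Dec (u Fin.< v)
      u<v = u <? v
      v<w : Dec (v Fin.< w)
      v<w = v <? w
      uv : Dec (Adj H u v)
      uv = adj? H u v
      vw : Dec (Adj H v w)
      vw = adj? H v w
      uw : Dec (Adj H u w)
      uw = adj? H u w
      reassociate : ∀ a b c d e → a * (b * (c * (d * e))) ≡ a * b * (c * d * e)
      reassociate = solve-∀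

  ∑³Δ≡6*numTriangles : ∑³ Δ ≡ 6 * numTriangles H
  ∑³Δ≡6*numTriangles = begin
    ∑³ Δ
      ≡⟨ ∑³-cong Δ≡∑sortedΔ ⟩
    ∑³ (λ u v w → sortedΔ u v w + sortedΔ u w v + sortedΔ v u w + sortedΔ v w u + sortedΔ w u v + sortedΔ w v u)
      ≡⟨ ∑³-permutations sortedΔ ⟩
    6 * ∑³ sortedΔ
      ≡⟨ cong (6 *_) numTriangles≡∑³sortedΔ ⟨
    6 * numTriangles H ∎

  -- Weighted ordered counts of edges and triangles

  E : (Fin n → ℕ) → ℕ
  E ω = ∑² (λ u v → ω u * ω v * A u v)

  T : (Fin n → ℕ) → ℕ
  T ω = ∑³ (λ u v w → ω u * ω v * ω w * Δ u v w)

  E-cong : ∀ {ω ω′} → (∀ x → ω x ≡ ω′ x) → E ω ≡ E ω′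
  E-cong ω≗ω′ = ∑²-cong λ u v → cong₂ (λ a b → a * b * A u v) (ω≗ω′ u) (ω≗ω′ v)

  T-cong : ∀ {ω ω′} → (∀ x → ω x ≡ ω′ x) → T ω ≡ T ω′
  T-cong ω≗ω′ = ∑³-cong λ u v w → cong₂ (λ ab c → ab * c * Δ u v w) (cong₂ _*_ (ω≗ω′ u) (ω≗ω′ v)) (ω≗ω′ w)

  _∩N_ : (Fin n → ℕ) → Fin n → Fin n → ℕ
  (ω ∩N w) a = ω a * A w a

  E-insert : ∀ ω w → E (λ x → ω x + δ w x) ≡ E ω + 2 * sum (ω ∩N w)
  E-insert ω w = begin
    E (λ x → ω x + δ w x)
      ≡⟨ ∑²-cong expand ⟩
    ∑² (λ u v → ω u * ω v * A u v + (δ w u * (ω v * A u v) + δ w v * (ω u * A u v)))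
      ≡⟨ ∑²-distrib-+ {n} _ _ ⟩
    E ω + ∑² (λ u v → δ w u * (ω v * A u v) + δ w v * (ω u * A u v))
      ≡⟨ cong (E ω +_) (∑²-distrib-+ {n} _ _) ⟩
    E ω + (∑² (λ u v → δ w u * (ω v * A u v)) + ∑² (λ u v → δ w v * (ω u * A u v)))
      ≡⟨ cong (E ω +_) (cong₂ _+_ (∑²-δ₁ w (λ u v → ω v * A u v)) (sum-cong-≗ {n} λ u → ∑-δ w (λ v → ω u * A u v))) ⟩
    E ω + (sum (ω ∩N w) + ∑[ u < n ] (ω u * A u w))
      ≡⟨ cong (λ s → E ω + (sum (ω ∩N w) + s)) (sum-cong-≗ {n} λ u → cong (ω u *_) (A-sym u w)) ⟩
    E ω + (sum (ω ∩N w) + sum (ω ∩N w))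
      ≡⟨ cong (λ s → E ω + (sum (ω ∩N w) + s)) (+-identityʳ (sum (ω ∩N w))) ⟨
    E ω + 2 * sum (ω ∩N w) ∎
    where
    expansion : ∀ a b da db m → (a + da) * (b + db) * m ≡ a * b * m + (da * (b * m) + db * (a * m)) + da * db * m
    expansion = solve-∀
    expand : ∀ u v → (ω u + δ w u) * (ω v + δ w v) * A u v ≡ ω u * ω v * A u v + (δ w u * (ω v * A u v) + δ w v * (ω u * A u v))
    expand u v = drop-vanishing (expansion (ω u) (ω v) (δ w u) (δ w v) (A u v)) (δδ-diagonal w A (A-irrefl w) u v)

  T-insert : ∀ ω w → T (λ x → ω x + δ w x) ≡ T ω + 3 * E (ω ∩N w)
  T-insert ω w = begin
    T (λ x → ω x + δ w x)
      ≡⟨ ∑³-cong expand ⟩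
    ∑³ (λ u v x → ω u * ω v * ω x * Δ u v x + (t₁ u v x + t₂ u v x + t₃ u v x))
      ≡⟨ ∑³-distrib-+ {n} _ _ ⟩
    T ω + ∑³ (λ u v x → t₁ u v x + t₂ u v x + t₃ u v x)
      ≡⟨ cong (T ω +_) (∑³-distrib-+ {n} _ t₃) ⟩
    T ω + (∑³ (λ u v x → t₁ u v x + t₂ u v x) + ∑³ t₃)
      ≡⟨ cong (λ s → T ω + (s + ∑³ t₃)) (∑³-distrib-+ t₁ t₂) ⟩
    T ω + (∑³ t₁ + ∑³ t₂ + ∑³ t₃)
      ≡⟨ cong (T ω +_) (cong₂ _+_ (cong₂ _+_ ∑t₁ ∑t₂) ∑t₃) ⟩
    T ω + (E (ω ∩N w) + E (ω ∩N w) + E (ω ∩N w))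
      ≡⟨ cong (T ω +_) (three-times (E (ω ∩N w))) ⟩
    T ω + 3 * E (ω ∩N w) ∎
    where
    t₁ t₂ t₃ : Fin n → Fin n → Fin n → ℕ
    t₁ u v x = δ w u * (ω v * ω x * Δ u v x)
    t₂ u v x = δ w v * (ω u * ω x * Δ u v x)
    t₃ u v x = δ w x * (ω u * ω v * Δ u v x)

    expansion : ∀ a b c da db dc m → (a + da) * (b + db) * (c + dc) * m ≡
      a * b * c * m + (da * (b * c * m) + db * (a * c * m) + dc * (a * b * m))
      + ((c + dc) * (da * db * m) + b * (da * dc * m) + a * (db * dc * m))
    expansion = solve-∀
    vanishing : ∀ a b c {x y z} → x ≡ 0 → y ≡ 0 → z ≡ 0 → a * x + b * y + c * z ≡ 0
    vanishing a b c refl refl refl rewrite *-zeroʳ a | *-zeroʳ b | *-zeroʳ c = refl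
    expand : ∀ u v x → (ω u + δ w u) * (ω v + δ w v) * (ω x + δ w x) * Δ u v x ≡
                       ω u * ω v * ω x * Δ u v x + (t₁ u v x + t₂ u v x + t₃ u v x)
    expand u v x = drop-vanishing (expansion (ω u) (ω v) (ω x) (δ w u) (δ w v) (δ w x) (Δ u v x))
      (vanishing (ω x + δ w x) (ω v) (ω u)
        (δδ-diagonal w (λ u v → Δ u v x) (Δ-diagonal₁₂ w x) u v)
        (δδ-diagonal w (λ u x → Δ u v x) (Δ-diagonal₁₃ w v) u x)
        (δδ-diagonal w (λ v x → Δ u v x) (Δ-diagonal₂₃ u w) v x))

    rearrange₁ : ∀ a b p q r → a * b * (p * q * r) ≡ a * p * (b * r) * q
    rearrange₁ = solve-∀
    rearrange₂ : ∀ a b p q r → a * b * (p * q * r) ≡ a * p * (b * q) * r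
    rearrange₂ = solve-∀
    rearrange₃ : ∀ a b p q r → a * b * (p * q * r) ≡ a * r * (b * q) * p
    rearrange₃ = solve-∀
    three-times : ∀ x → x + x + x ≡ 3 * x
    three-times = solve-∀

    ∑t₁ : ∑³ t₁ ≡ E (ω ∩N w)
    ∑t₁ = trans (∑³-δ₁ w (λ u v x → ω v * ω x * Δ u v x))
                (∑²-cong λ v x → rearrange₁ (ω v) (ω x) (A w v) (A v x) (A w x))
    ∑t₂ : ∑³ t₂ ≡ E (ω ∩N w)
    ∑t₂ = trans (sum-cong-≗ {n} λ u → ∑²-δ₁ w (λ v x → ω u * ω x * Δ u v x))
                (∑²-cong λ u x → trans (cong (λ a → ω u * ω x * (a * A w x * A u x)) (A-sym u w))
                                       (rearrange₂ (ω u) (ω x) (A w u) (A w x) (A u x)))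
    ∑t₃ : ∑³ t₃ ≡ E (ω ∩N w)
    ∑t₃ = trans (∑²-cong λ u v → ∑-δ w (λ x → ω u * ω v * Δ u v x))
                (∑²-cong λ u v → trans (cong₂ (λ a b → ω u * ω v * (A u v * a * b)) (A-sym v w) (A-sym u w))
                                       (rearrange₃ (ω u) (ω v) (A u v) (A w v) (A w u)))

  E≡∑[ω*deg] : ∀ ω → E ω ≡ ∑[ u < n ] (ω u * ∑[ v < n ] (ω v * A u v))
  E≡∑[ω*deg] ω = sum-cong-≗ {n} λ u → trans (sum-cong-≗ {n} λ v → *-assoc (ω u) (ω v) (A u v))
                                            (sym (*-distribˡ-sum (ω u) (λ v → ω v * A u v)))

  E-bound : (r : Fin n → ℕ) → (∀ a → r a ≤ 1) → E r + sum r ≤ sum r * sum r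
  E-bound r r≤1 = subst₂ _≤_ ∑≡E+∑r (sym (*-distribʳ-sum (sum r) r))
                    (∑-mono-≤ λ u → scale (r≤1 u) (others-bound u))
    where
    degᵣ : Fin n → ℕ
    degᵣ u = ∑[ v < n ] (r v * A u v)

    ∑≡E+∑r : ∑[ u < n ] (r u * degᵣ u + r u) ≡ E r + sum r
    ∑≡E+∑r = trans (∑-distrib-+ (λ u → r u * degᵣ u) r) (cong (_+ sum r) (sym (E≡∑[ω*deg] r)))

    scale : ∀ {m x y} → m ≤ 1 → (m ≡ 1 → x + 1 ≤ y) → m * x + m ≤ m * y
    scale z≤n       _      = z≤n
    scale {x = x} {y} (s≤s z≤n) 1+x≤y = subst₂ _≤_ (cong (_+ 1) (sym (+-identityʳ x))) (sym (+-identityʳ y)) (1+x≤y refl)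

    others-bound : ∀ u → r u ≡ 1 → degᵣ u + 1 ≤ sum r
    others-bound u ru≡1 = subst (_≤ sum r) ∑≡degᵣ+1 (∑-mono-≤ pointwise)
      where
      ∑≡degᵣ+1 : ∑[ v < n ] (r v * A u v + δ u v) ≡ degᵣ u + 1
      ∑≡degᵣ+1 = trans (∑-distrib-+ (λ v → r v * A u v) (δ u)) (cong (degᵣ u +_) (∑δ≡1 u))
      pointwise : ∀ v → r v * A u v + δ u v ≤ r v
      pointwise v with v ≟ u
      ... | yes refl rewrite A-irrefl v | *-zeroʳ (r v) | ru≡1 = ≤-refl
      ... | no _     = subst (_≤ r v) (sym (trans (+-identityʳ _) (*-comm (r v) (A u v)))) (*≤-of-≤1 (r v) (A≤1 u v))

  E-occurrences : ∀ as → E (occurrences as) ≡ ListAction.sum (map (λ u → ListAction.sum (map (A u) as)) as)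
  E-occurrences as = begin
    E (occurrences as)
      ≡⟨ E≡∑[ω*deg] (occurrences as) ⟩
    ∑[ u < n ] (occurrences as u * ∑[ v < n ] (occurrences as v * A u v))
      ≡⟨ sum-cong-≗ {n} (λ u → cong (occurrences as u *_) (∑-occurrences as (A u))) ⟩
    ∑[ u < n ] (occurrences as u * ListAction.sum (map (A u) as))
      ≡⟨ ∑-occurrences as (λ u → ListAction.sum (map (A u) as)) ⟩
    ListAction.sum (map (λ u → ListAction.sum (map (A u) as)) as) ∎

  E-triangle : ∀ a b c → E (occurrences (a ∷ b ∷ c ∷ [])) ≡ 2 * (A a b + A a c + A b c)
  E-triangle a b c
    rewrite E-occurrences (a ∷ b ∷ c ∷ []) | A-irrefl a | A-irrefl b | A-irrefl c
          | A-sym b a | A-sym c a | A-sym c b = collect (A a b) (A a c) (A b c)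
    where
    collect : ∀ x y z → 0 + (x + (y + 0)) + (x + (0 + (z + 0)) + (y + (z + (0 + 0)) + 0)) ≡ 2 * (x + y + z)
    collect = solve-∀

  -- A K₄ inside a connected graph of maximum degree 3

  module K₄ (connected : Connected H) (deg≤3 : ∀ v → degree H v ≤ 3) {a b c d : Fin n}
            (ab : Adj H a b) (ac : Adj H a c) (ad : Adj H a d)
            (bc : Adj H b c) (bd : Adj H b d) (cd : Adj H c d) where

    corner : Fin 4 → Fin n
    corner 0F = a
    corner 1F = b
    corner 2F = c
    corner 3F = d

    corner-adj : ∀ i j → i ≢ j → Adj H (corner i) (corner j)
    corner-adj 0F 0F i≢j = contradiction refl i≢j
    corner-adj 0F 1F _   = ab
    corner-adj 0F 2F _   = ac
    corner-adj 0F 3F _   = ad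
    corner-adj 1F 0F _   = adj-sym H ab
    corner-adj 1F 1F i≢j = contradiction refl i≢j
    corner-adj 1F 2F _   = bc
    corner-adj 1F 3F _   = bd
    corner-adj 2F 0F _   = adj-sym H ac
    corner-adj 2F 1F _   = adj-sym H bc
    corner-adj 2F 2F i≢j = contradiction refl i≢j
    corner-adj 2F 3F _   = cd
    corner-adj 3F 0F _   = adj-sym H ad
    corner-adj 3F 1F _   = adj-sym H bd
    corner-adj 3F 2F _   = adj-sym H cd
    corner-adj 3F 3F i≢j = contradiction refl i≢j

    corner-injective : ∀ {i j} → corner i ≡ corner j → i ≡ j
    corner-injective {i} {j} eq with i ≟ j
    ... | yes i≡j = i≡j
    ... | no  i≢j = contradiction eq (Adj⇒≢ (corner-adj i j i≢j))

    neighbour-of-corner : ∀ i {z} → Adj H (corner i) z → ∃[ j ] corner j ≡ z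
    neighbour-of-corner i {z} iz with any? (λ j → corner j ≟ z)
    ... | yes found  = found
    ... | no  ¬found = contradiction (≤-trans four≤degree (deg≤3 (corner i))) (<⇒≱ (n<1+n 3))
      where
      others : Fin 3 → Fin n
      others = corner ∘ punchIn i
      four≤degree : 4 ≤ degree H (corner i)
      four≤degree = Unique⇒length≤degree {as = z ∷ tabulate others}
        (All.tabulate⁺ (λ j z≡ → ¬found (punchIn i j , sym z≡))
          ∷ Unique.tabulate⁺ (λ eq → punchIn-injective i _ _ (corner-injective eq)))
        (iz ∷ All.tabulate⁺ (λ j → corner-adj i (punchIn i j) (punchInᵢ≢i i j ∘ sym)))

    reached : ∀ {u v} → ∃[ i ] corner i ≡ u → Walk H u v → ∃[ j ] corner j ≡ v
    reached u∈ here                    = u∈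
    reached (i , refl) (step iz walk) = reached (neighbour-of-corner i iz) walk

    index : Fin n → Fin 4
    index x = proj₁ (reached (0F , refl) (connected a x))

    corner-index : ∀ x → corner (index x) ≡ x
    corner-index x = proj₂ (reached (0F , refl) (connected a x))

    index-corner : ∀ i → index (corner i) ≡ i
    index-corner i = corner-injective (corner-index (corner i))

    ≅K₄ : H ≅ K 4
    ≅K₄ = record
      { f    = ↔⇒⤖ (mk↔ₛ′ index corner index-corner corner-index)
      ; adj⇔ = λ u v → preserve , reflect u v
      }
      where
      preserve : ∀ {u v} → Adj H u v → index u ≢ index v
      preserve {u} {v} uv eq = Adj⇒≢ uv (trans (sym (corner-index u)) (trans (cong corner eq) (corner-index v)))
      reflect : ∀ u v → index u ≢ index v → Adj H u v
      reflect u v ne = subst₂ (Adj H) (corner-index u) (corner-index v) (corner-adj (index u) (index v) ne)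

  neighbourhood-edges-bound : Connected H → (∀ v → degree H v ≤ 3) → ¬ (H ≅ K 4) →
    ∀ ω w → (∀ x → ω x ≤ 1) → 0 < sum (ω ∩N w) → 2 + E (ω ∩N w) ≤ 2 * sum (ω ∩N w)
  neighbourhood-edges-bound connected deg≤3 ≇K₄ ω w ω≤1 k>0 = 2+p≤2*k k>0 k≤3 (E-bound r r≤1) saturated
    where
    r : Fin n → ℕ
    r = ω ∩N w
    r≤A : ∀ x → r x ≤ A w x
    r≤A x = *≤-of-≤1 (A w x) (ω≤1 x)
    r≤1 : ∀ x → r x ≤ 1
    r≤1 x = ≤-trans (r≤A x) (A≤1 w x)
    k≤3 : sum r ≤ 3
    k≤3 = ≤-trans (∑-mono-≤ r≤A) (subst (_≤ 3) (degree≡∑A w) (deg≤3 w))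

    ≅K₄-from-support : ∃[ as ] length as ≡ 3 × (∀ x → r x ≡ occurrences as x) → 5 ≤ E r → H ≅ K 4
    ≅K₄-from-support ([]                  , () , _)
    ≅K₄-from-support (_ ∷ []              , () , _)
    ≅K₄-from-support (_ ∷ _ ∷ []          , () , _)
    ≅K₄-from-support (_ ∷ _ ∷ _ ∷ _ ∷ _   , () , _)
    ≅K₄-from-support (a ∷ b ∷ c ∷ [] , _ , r≗as) 5≤E =
      K₄.≅K₄ connected deg≤3 (w-adj (here refl)) (w-adj (there (here refl))) (w-adj (there (there (here refl))))
                             (A>0⇒Adj ab) (A>0⇒Adj ac) (A>0⇒Adj bc)
      where
      E≡ : E r ≡ 2 * (A a b + A a c + A b c)
      E≡ = trans (E-cong r≗as) (E-triangle a b c)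
      adjacent : 0 < A a b × 0 < A a c × 0 < A b c
      adjacent = all-positive (A≤1 a b) (A≤1 a c) (A≤1 b c) (subst (5 ≤_) E≡ 5≤E)
      ab : 0 < A a b
      ab = proj₁ adjacent
      ac : 0 < A a c
      ac = proj₁ (proj₂ adjacent)
      bc : 0 < A b c
      bc = proj₂ (proj₂ adjacent)
      w-adj : ∀ {x} → x List.∈ a ∷ b ∷ c ∷ [] → Adj H w x
      w-adj {x} x∈ = A>0⇒Adj (≤-trans (subst (0 <_) (sym (r≗as x)) (∈⇒0<occurrences x∈)) (r≤A x))

    saturated : sum r ≡ 3 → ¬ 5 ≤ E r
    saturated k≡3 5≤E = ≇K₄ (≅K₄-from-support (≤1⇒occurrences 3 r r≤1 k≡3) 5≤E)

  -- Growing a vertex set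

  TriangleBound : Subset n → Set
  TriangleBound s = 6 * ∣ s ∣ + T (χ s) ≤ 3 * E (χ s) + 6

  TriangleBound-⁅⁆ : ∀ v → TriangleBound ⁅ v ⁆
  TriangleBound-⁅⁆ v = subst₂ (λ c t → 6 * c + t ≤ 3 * E (χ ⁅ v ⁆) + 6) (sym (∣⁅x⁆∣≡1 v)) (sym T≡0)
                          (m≤n+m 6 (3 * E (χ ⁅ v ⁆)))
    where
    T≡0 : T (χ ⁅ v ⁆) ≡ 0
    T≡0 = trans (T-cong (χ-⁅⁆ v)) (∑³≡0 λ x y z → begin
      δ v x * δ v y * δ v z * Δ x y z      ≡⟨ rearrange (δ v x) (δ v y) (δ v z) (Δ x y z) ⟩
      δ v z * (δ v x * δ v y * Δ x y z)    ≡⟨ cong (δ v z *_) (δδ-diagonal v (λ x y → Δ x y z) (Δ-diagonal₁₂ v z) x y) ⟩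
      δ v z * 0                            ≡⟨ *-zeroʳ (δ v z) ⟩
      0                                    ∎)
      where
      rearrange : ∀ a b c d → a * b * c * d ≡ c * (a * b * d)
      rearrange = solve-∀

  boundary-edge : ∀ {s u v} → u ∈ s → v ∉ s → Walk H u v → ∃[ p ] ∃[ w ] p ∈ s × w ∉ s × Adj H p w
  boundary-edge u∈s v∉s here = contradiction u∈s v∉s
  boundary-edge {s} u∈s v∉s (step {w = z} uz walk) with z ∈? s
  ... | yes z∈s = boundary-edge z∈s v∉s walk
  ... | no  z∉s = _ , _ , u∈s , z∉s , uz

  module Growth (connected : Connected H) (deg≤3 : ∀ v → degree H v ≤ 3) (≇K₄ : ¬ (H ≅ K 4)) where

    insert-preserves : ∀ {s p w} → p ∈ s → w ∉ s → Adj H p w → TriangleBound s → TriangleBound (s ∪ ⁅ w ⁆)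
    insert-preserves {s} {p} {w} p∈s w∉s pw bound =
      subst₂ _≤_ (cong₂ (λ c t → 6 * c + t) (sym ∣s∪w∣≡) (sym T≡)) (cong (λ e → 3 * e + 6) (sym E≡))
                 (combine ∣ s ∣ (T (χ s)) (E (χ s)) (E (χ s ∩N w)) k bound new)
      where
      k : ℕ
      k = sum (χ s ∩N w)
      k>0 : 0 < k
      k>0 = ≤-trans (≤-reflexive (sym (cong₂ _*_ (𝟙-yes (p ∈? s) p∈s) (Adj⇒A≡1 (adj-sym H pw)))))
                    (≤∑ (χ s ∩N w) p)
      new : 2 + E (χ s ∩N w) ≤ 2 * k
      new = neighbourhood-edges-bound connected deg≤3 ≇K₄ (χ s) w (χ≤1 s) k>0
      ∣s∪w∣≡ : ∣ s ∪ ⁅ w ⁆ ∣ ≡ ∣ s ∣ + 1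
      ∣s∪w∣≡ = trans (∣∪⁅⁆∣ w∉s) (+-comm 1 ∣ s ∣)
      T≡ : T (χ (s ∪ ⁅ w ⁆)) ≡ T (χ s) + 3 * E (χ s ∩N w)
      T≡ = trans (T-cong (χ-∪⁅⁆ w∉s)) (T-insert (χ s) w)
      E≡ : E (χ (s ∪ ⁅ w ⁆)) ≡ E (χ s) + 2 * k
      E≡ = trans (E-cong (χ-∪⁅⁆ w∉s)) (E-insert (χ s) w)
      combine : ∀ c t e q k → 6 * c + t ≤ 3 * e + 6 → 2 + q ≤ 2 * k →
                6 * (c + 1) + (t + 3 * q) ≤ 3 * (e + 2 * k) + 6
      combine c t e q k old new = subst₂ _≤_ (lhs c t q) (rhs e k) (+-mono-≤ old (*-monoʳ-≤ 3 new))
        where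
        lhs : ∀ c t q → 6 * c + t + 3 * (2 + q) ≡ 6 * (c + 1) + (t + 3 * q)
        lhs = solve-∀
        rhs : ∀ e k → 3 * e + 6 + 3 * (2 * k) ≡ 3 * (e + 2 * k) + 6
        rhs = solve-∀

    grow : ∀ k {s} → k + ∣ s ∣ ≡ n → ∃[ v ] v ∈ s → TriangleBound s → TriangleBound Subset.⊤
    grow zero    ∣s∣≡n _ bound = subst TriangleBound (∣p∣≡n⇒p≡⊤ ∣s∣≡n) bound
    grow (suc k) {s} k+∣s∣≡n (v , v∈s) bound =
      let x , x∉s = ∣∣<n⇒∃∉ s (≤-trans (s≤s (m≤n+m ∣ s ∣ k)) (≤-reflexive k+∣s∣≡n))
          p , w , p∈s , w∉s , pw = boundary-edge v∈s x∉s (connected v x)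
      in grow k (trans (cong (k +_) (∣∪⁅⁆∣ w∉s)) (trans (+-suc k ∣ s ∣) k+∣s∣≡n))
              (v , x∈p∪q⁺ (inj₁ v∈s)) (insert-preserves p∈s w∉s pw bound)

    triangle-bound : Fin n → 6 * n + ∑³ Δ ≤ 3 * ∑² A + 6
    triangle-bound v = subst₂ _≤_ (cong₂ (λ c t → 6 * c + t) (∣⊤∣≡n n) T⊤≡) (cong (λ e → 3 * e + 6) E⊤≡)
      (grow (n ∸ 1) (trans (cong (n ∸ 1 +_) (∣⁅x⁆∣≡1 v)) (m∸n+n≡m 1≤n)) (v , x∈⁅x⁆ v) (TriangleBound-⁅⁆ v))
      where
      1≤n : 1 ≤ n
      1≤n = ≤-trans (s≤s z≤n) (toℕ<n v)
      T⊤≡ : T (χ Subset.⊤) ≡ ∑³ Δ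
      T⊤≡ = trans (T-cong χ-⊤) (∑³-cong λ u v w → *-identityˡ (Δ u v w))
      E⊤≡ : E (χ Subset.⊤) ≡ ∑² A
      E⊤≡ = trans (E-cong χ-⊤) (∑²-cong λ u v → *-identityˡ (A u v))

proposition15 : ∀ {n} (H : Graph n) → Connected H → MaxDegree H 3 → ¬ (H ≅ K 4) →
                2 * numTriangles H ∸ 2 ≤ numDeg H 3
proposition15 {n} H connected (deg≤3 , v , _) ≇K₄ =
  2t∸2≤d n (numTriangles H) (∑² (A H)) (numDeg H 3) cyclomatic (∑²A≤2n+numDeg3 H deg≤3)
  where
  cyclomatic : 6 * n + 6 * numTriangles H ≤ 3 * ∑² (A H) + 6
  cyclomatic = subst (λ t → 6 * n + t ≤ 3 * ∑² (A H) + 6) (∑³Δ≡6*numTriangles H)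
                     (Growth.triangle-bound H connected deg≤3 ≇K₄ v)
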